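{- If $G$ is a graph with connected components $G_1,\ldots,G_c$, then $\mathrm{sn}(G)=\max_i \mathrm{sn}(G_i)$.
   Context: Graphs are finite, multiple edges allowed, no loops, possibly disconnected. A scramble on $G$ is a finite collection of nonempty vertex sets (eggs) each inducing a connected subgraph; its order is $\min(h,e)$ where $h$ is the minimum size of a vertex set meeting every egg and $e$ is the minimum of $|E(A,A^C)|$ (number of edges between $A$ and $A^C$) over all $A\subseteq V(G)$ such that some egg is contained in $A$ and some egg in $A^C$ ($+\infty$ if none). The scramble number $\mathrm{sn}(G)$ is the maximum order of a scramble on $G$. -}

module Defs where

open import Data.Nat using (ℕ; zero; suc; _+_; _≤_; _<_; _⊓_; _⊔_)
open import Data.Fin using (Fin; zero; suc)
open import Data.Fin.Subset using (Subset; _∈_; _⊆_; ∁; ∣_∣; Nonempty)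
open import Data.Bool using (Bool; true; false; _∧_; not; if_then_else_)
open import Data.Vec using (lookup)
open import Data.List using (List)
open import Data.List.Relation.Unary.All using (All)
open import Data.List.Relation.Unary.Any using (Any)
open import Data.Maybe using (Maybe; just; nothing)
open import Data.Product using (Σ; ∃; ∃-syntax; _×_; _,_)
open import Relation.Binary.PropositionalEquality using (_≡_)
open import Relation.Nullary using (¬_)
open import Function.Definitions using (Injective)

record Graph (n : ℕ) : Set where
  field
    mult     : Fin n → Fin n → ℕ
    symm     : ∀ u v → mult u v ≡ mult v u
    loopless : ∀ u → mult u u ≡ 0

open Graph public

sumFin : (n : ℕ) → (Fin n → ℕ) → ℕ
sumFin zero    f = 0
sumFin (suc n) f = f zero + sumFin n (λ i → f (suc i))

maxFin : (n : ℕ) → (Fin n → ℕ) → ℕ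
maxFin zero    f = 0
maxFin (suc n) f = f zero ⊔ maxFin n (λ i → f (suc i))

data WalkIn {n : ℕ} (G : Graph n) (A : Subset n) : Fin n → Fin n → Set where
  stop : ∀ {u} → u ∈ A → WalkIn G A u u
  step : ∀ {u w v} → u ∈ A → 0 < mult G u w → WalkIn G A w v → WalkIn G A u v

InducesConnected : ∀ {n} → Graph n → Subset n → Set
InducesConnected G A = Nonempty A × (∀ {u v} → u ∈ A → v ∈ A → WalkIn G A u v)

data Walk {n : ℕ} (G : Graph n) : Fin n → Fin n → Set where
  stop : ∀ {u} → Walk G u u
  step : ∀ {u w v} → 0 < mult G u w → Walk G w v → Walk G u v

Connected : ∀ {n} → Graph n → Set
Connected {n} G = Fin n × (∀ u v → Walk G u v)

Egg : ∀ {n} → Graph n → Subset n → Set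
Egg G A = InducesConnected G A

IsScramble : ∀ {n} → Graph n → List (Subset n) → Set
IsScramble G S = All (Egg G) S

Hits : ∀ {n} → List (Subset n) → Subset n → Set
Hits S H = All (λ E → ∃[ v ] (v ∈ E × v ∈ H)) S

cut : ∀ {n} → Graph n → Subset n → ℕ
cut {n} G A = sumFin n (λ u → sumFin n (λ v →
  if lookup A u ∧ not (lookup A v) then mult G u v else 0))

Separates : ∀ {n} → List (Subset n) → Subset n → Set
Separates S A = Any (λ E → E ⊆ A) S × Any (λ E → E ⊆ ∁ A) S

IsHittingNumber : ∀ {n} → List (Subset n) → ℕ → Set
IsHittingNumber {n} S h =
  (∃[ H ] (Hits S H × ∣ H ∣ ≡ h)) × (∀ (H : Subset n) → Hits S H → h ≤ ∣ H ∣)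

-- e (nothing = +∞) is the minimum cut size over separating sets
IsEggCutNumber : ∀ {n} → Graph n → List (Subset n) → Maybe ℕ → Set
IsEggCutNumber {n} G S nothing = ∀ (A : Subset n) → ¬ Separates S A
IsEggCutNumber {n} G S (just e) =
  (∃[ A ] (Separates S A × cut G A ≡ e)) × (∀ (A : Subset n) → Separates S A → e ≤ cut G A)

minInf : ℕ → Maybe ℕ → ℕ
minInf h nothing  = h
minInf h (just e) = h ⊓ e

IsOrder : ∀ {n} → Graph n → List (Subset n) → ℕ → Set
IsOrder G S o = ∃[ h ] ∃[ e ] (IsHittingNumber S h × IsEggCutNumber G S e × o ≡ minInf h e)

IsScrambleNumber : ∀ {n} → Graph n → ℕ → Set
IsScrambleNumber {n} G s =
  (∃[ S ] (IsScramble G S × IsOrder G S s))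
  × (∀ (S : List (Subset n)) (o : ℕ) → IsScramble G S → IsOrder G S o → o ≤ s)

record Components {n : ℕ} (G : Graph n) (c : ℕ) : Set where
  field
    size    : Fin c → ℕ
    comp    : (i : Fin c) → Graph (size i)
    emb     : (i : Fin c) → Fin (size i) → Fin n
    emb-inj : ∀ i → Injective _≡_ _≡_ (emb i)
    induced : ∀ i a b → mult (comp i) a b ≡ mult G (emb i a) (emb i b)
    conn    : ∀ i → Connected (comp i)
    closed  : ∀ i a v → (∀ b → ¬ (emb i b ≡ v)) → mult G (emb i a) v ≡ 0
    cover   : ∀ v → ∃[ i ] ∃[ a ] (emb i a ≡ v)
    disjoint : ∀ i j a b → emb i a ≡ emb j b → i ≡ j

-- Every egg is connected, so it lies inside a single component. If all eggs of a
-- scramble lie in one component, restricting to that component changes neither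
-- the hitting number nor the egg-cut number, since the embedding of a component
-- preserves cardinalities and cuts of images and can only shrink them on
-- preimages. Otherwise the vertex set of the component of the first egg separates
-- the scramble with a cut of size 0. Conversely the image of an optimal scramble
-- of a component is a scramble of G of the same order.
module Submission where

open import Defs

open import Data.Bool using (true; false; _∧_; not; if_then_else_)
open import Data.Bool.Properties using (if-eta)
open import Data.Empty using (⊥-elim)
open import Data.Fin using (Fin; zero; suc; punchIn; punchOut)
open import Data.Fin.Properties
  using (any?; 0≢1+n; suc-injective; punchIn-punchOut; punchOut-injective; punchInᵢ≢i; punchIn-injective)
  renaming (_≟_ to _≟ᶠ_)
open import Data.Fin.Subset using (Subset; _∈_; _⊆_; ∁; ∣_∣; ⊤; ⊥)
open import Data.Fin.Subset.Properties using (_∈?_; x∈∁p⇒x∉p; x∉p⇒x∈∁p; ∈⊤; ∣⊥∣≡0; ⊆-antisym)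
open import Data.List using (List; []; _∷_; map)
open import Data.List.Relation.Unary.All as All using (All; []; _∷_)
open import Data.List.Relation.Unary.Any as Any using (Any; here; there)
import Data.List.Relation.Unary.All.Properties as All
import Data.List.Relation.Unary.Any.Properties as Any
open import Data.Maybe using (just; nothing)
open import Data.Nat using (ℕ; zero; suc; _+_; _≤_; _<_; z≤n)
open import Data.Nat.Properties
  using (+-mono-≤; ≤-refl; ≤-trans; ≤-antisym; ≤-reflexive; <-irrefl; m⊓n≤m; m⊓n≤n; m≤m⊔n; m≤n⊔m;
         ⊔-identityʳ; ⊔-sel; +-commutativeSemigroup; module ≤-Reasoning)
open import Algebra.Properties.CommutativeSemigroup +-commutativeSemigroup using (x∙yz≈y∙xz)
open import Data.Product using (∃-syntax; _×_; _,_; proj₁; proj₂)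
open import Data.Sum using (_⊎_; inj₁; inj₂)
import Data.Sum as Sum
open import Data.Vec using ([]; _∷_; lookup; tabulate)
open import Data.Vec.Properties using (lookup∘tabulate; lookup-replicate; []=⇒lookup; lookup⇒[]=)
open import Function using (_∘_)
open import Function.Bundles using (_⇔_; mk⇔; Equivalence)
open import Function.Definitions using (Injective)
open import Relation.Binary.PropositionalEquality
open import Relation.Nullary using (¬_; Dec; yes; no; does)
open import Relation.Nullary.Decidable using (_×-dec_; dec-true; dec-false; does-⇔)

open Equivalence using (to; from)

sumFin-cong : ∀ n {g h : Fin n → ℕ} → (∀ v → g v ≡ h v) → sumFin n g ≡ sumFin n h
sumFin-cong zero    g≗h = refl
sumFin-cong (suc n) g≗h = cong₂ _+_ (g≗h zero) (sumFin-cong n (g≗h ∘ suc))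

sumFin-mono : ∀ n {g h : Fin n → ℕ} → (∀ v → g v ≤ h v) → sumFin n g ≤ sumFin n h
sumFin-mono zero    g≤h = z≤n
sumFin-mono (suc n) g≤h = +-mono-≤ (g≤h zero) (sumFin-mono n (g≤h ∘ suc))

sumFin-zero : ∀ n {g : Fin n → ℕ} → (∀ v → g v ≡ 0) → sumFin n g ≡ 0
sumFin-zero zero    g≗0 = refl
sumFin-zero (suc n) g≗0 = cong₂ _+_ (g≗0 zero) (sumFin-zero n (g≗0 ∘ suc))

sumFin-punchIn : ∀ n (g : Fin (suc n) → ℕ) p → sumFin (suc n) g ≡ g p + sumFin n (g ∘ punchIn p)
sumFin-punchIn n       g zero    = refl
sumFin-punchIn (suc n) g (suc p) = begin
  g zero + sumFin (suc n) (g ∘ suc)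
    ≡⟨ cong (g zero +_) (sumFin-punchIn n (g ∘ suc) p) ⟩
  g zero + (g (suc p) + sumFin n (g ∘ suc ∘ punchIn p))
    ≡⟨ x∙yz≈y∙xz (g zero) (g (suc p)) _ ⟩
  g (suc p) + (g zero + sumFin n (g ∘ suc ∘ punchIn p)) ∎
  where open ≡-Reasoning

module _ {m n : ℕ} (f : Fin (suc m) → Fin (suc n)) (f-inj : Injective _≡_ _≡_ f) where

  punchOut-tail : Fin m → Fin n
  punchOut-tail a = punchOut {i = f zero} {j = f (suc a)} (0≢1+n ∘ f-inj)

  punchIn-punchOut-tail : ∀ a → punchIn (f zero) (punchOut-tail a) ≡ f (suc a)
  punchIn-punchOut-tail a = punchIn-punchOut _

  punchOut-tail-injective : Injective _≡_ _≡_ punchOut-tail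
  punchOut-tail-injective eq = suc-injective (f-inj (punchOut-injective {i = f zero} _ _ eq))

sumFin-∘-injective : ∀ {m n} {f : Fin m → Fin n} → Injective _≡_ _≡_ f → (g : Fin n → ℕ) →
                     (∀ v → (∀ a → f a ≢ v) → g v ≡ 0) → sumFin m (g ∘ f) ≡ sumFin n g
sumFin-∘-injective {zero}  {n}           _     g g-off = sym (sumFin-zero n (λ v → g-off v λ ()))
sumFin-∘-injective {suc m} {zero}  {f}   _     _ _     with f zero
... | ()
sumFin-∘-injective {suc m} {suc n} {f} f-inj g g-off = begin
  g (f zero) + sumFin m (g ∘ f ∘ suc)
    ≡⟨ cong (g (f zero) +_) (sumFin-cong m (cong g ∘ punchIn-punchOut-tail f f-inj)) ⟨
  g (f zero) + sumFin m (g ∘ punchIn (f zero) ∘ punchOut-tail f f-inj)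
    ≡⟨ cong (g (f zero) +_) (sumFin-∘-injective (punchOut-tail-injective f f-inj) _ g-off′) ⟩
  g (f zero) + sumFin n (g ∘ punchIn (f zero))
    ≡⟨ sumFin-punchIn n g (f zero) ⟨
  sumFin (suc n) g ∎
  where
  open ≡-Reasoning
  g-off′ : ∀ w → (∀ a → punchOut-tail f f-inj a ≢ w) → g (punchIn (f zero) w) ≡ 0
  g-off′ w w∉ = g-off _ λ where
    zero    eq → punchInᵢ≢i (f zero) w (sym eq)
    (suc a) eq → w∉ a (punchIn-injective (f zero) _ _ (trans (punchIn-punchOut-tail f f-inj a) eq))

sumFin-∘-injective-≤ : ∀ {m n} {f : Fin m → Fin n} → Injective _≡_ _≡_ f → (g : Fin n → ℕ) →
                       sumFin m (g ∘ f) ≤ sumFin n g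
sumFin-∘-injective-≤ {m} {n} {f} f-inj g = begin
  sumFin m (g ∘ f)          ≡⟨ sumFin-cong m on-range ⟨
  sumFin m (g-on-range ∘ f) ≡⟨ sumFin-∘-injective f-inj g-on-range off-range ⟩
  sumFin n g-on-range       ≤⟨ sumFin-mono n ≤g ⟩
  sumFin n g                ∎
  where
  open ≤-Reasoning
  range? : ∀ v → Dec (∃[ a ] f a ≡ v)
  range? v = any? λ a → f a ≟ᶠ v
  g-on-range : Fin n → ℕ
  g-on-range v = if does (range? v) then g v else 0
  on-range : ∀ a → g-on-range (f a) ≡ g (f a)
  on-range a rewrite dec-true (range? (f a)) (a , refl) = refl
  off-range : ∀ v → (∀ a → f a ≢ v) → g-on-range v ≡ 0
  off-range v v∉ rewrite dec-false (range? v) (λ (a , fa≡v) → v∉ a fa≡v) = refl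
  ≤g : ∀ v → g-on-range v ≤ g v
  ≤g v with does (range? v)
  ... | true  = ≤-refl
  ... | false = z≤n

does≡true⇒ : {A : Set} (a? : Dec A) → does a? ≡ true → A
does≡true⇒ (yes a) _ = a
does≡true⇒ (no _) ()

indicator : ∀ {n} → Subset n → Fin n → ℕ
indicator p v = if lookup p v then 1 else 0

∣p∣≡sumFin-indicator : ∀ {n} (p : Subset n) → ∣ p ∣ ≡ sumFin n (indicator p)
∣p∣≡sumFin-indicator []          = refl
∣p∣≡sumFin-indicator (true ∷ p)  = cong suc (∣p∣≡sumFin-indicator p)
∣p∣≡sumFin-indicator (false ∷ p) = ∣p∣≡sumFin-indicator p

lookup≡does-∈? : ∀ {n} (x : Fin n) (p : Subset n) → lookup p x ≡ does (x ∈? p)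
lookup≡does-∈? zero    (true ∷ p)  = refl
lookup≡does-∈? zero    (false ∷ p) = refl
lookup≡does-∈? (suc x) (_ ∷ p)     = lookup≡does-∈? x p

∈-resp-lookup : ∀ {m n} {p : Subset m} {q : Subset n} {x y} → lookup p x ≡ lookup q y → x ∈ p → y ∈ q
∈-resp-lookup {q = q} {y = y} eq x∈p = lookup⇒[]= y q (trans (sym eq) ([]=⇒lookup x∈p))

crossing : ∀ {n} → Graph n → Subset n → Fin n → Fin n → ℕ
crossing G A u v = if lookup A u ∧ not (lookup A v) then mult G u v else 0

cut-⊤ : ∀ {n} (G : Graph n) → cut G ⊤ ≡ 0
cut-⊤ {n} G = sumFin-zero n λ u → sumFin-zero n λ v →
  cong₂ (λ x y → if x ∧ not y then mult G u v else 0) (lookup-replicate u true) (lookup-replicate v true)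

walkIn-head : ∀ {n} {G : Graph n} {A u v} → WalkIn G A u v → u ∈ A
walkIn-head (stop u∈A)     = u∈A
walkIn-head (step u∈A _ _) = u∈A

-- Definitionally, IsHittingNumber S h is IsLeast (Hits S) ∣_∣ h and
-- IsEggCutNumber G S (just e) is IsLeast (Separates S) (cut G) e.
IsLeast : {X : Set} → (X → Set) → (X → ℕ) → ℕ → Set
IsLeast P μ m = (∃[ x ] (P x × μ x ≡ m)) × (∀ x → P x → m ≤ μ x)

module _ {X Y : Set} {P : X → Set} {Q : Y → Set} {μ : X → ℕ} {ν : Y → ℕ}
         (φ : X → Y) (φ-resp : ∀ {x} → P x → Q (φ x)) (φ-size : ∀ x → ν (φ x) ≡ μ x)
         (ψ : Y → X) (ψ-resp : ∀ {y} → Q y → P (ψ y)) (ψ-size : ∀ y → μ (ψ y) ≤ ν y) where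

  IsLeast-⇔ : ∀ {m} → IsLeast P μ m ⇔ IsLeast Q ν m
  IsLeast-⇔ {m} = mk⇔ forth back
    where
    P-least⇒ : (∀ x → P x → m ≤ μ x) → ∀ y → Q y → m ≤ ν y
    P-least⇒ least y Qy = ≤-trans (least (ψ y) (ψ-resp Qy)) (ψ-size y)
    Q-least⇒ : (∀ y → Q y → m ≤ ν y) → ∀ x → P x → m ≤ μ x
    Q-least⇒ least x Px = subst (m ≤_) (φ-size x) (least (φ x) (φ-resp Px))
    forth : IsLeast P μ m → IsLeast Q ν m
    forth ((x , Px , μx≡m) , least) = (φ x , φ-resp Px , trans (φ-size x) μx≡m) , P-least⇒ least
    back : IsLeast Q ν m → IsLeast P μ m
    back ((y , Qy , νy≡m) , least) =
      (ψ y , ψ-resp Qy ,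
       ≤-antisym (≤-trans (ψ-size y) (≤-reflexive νy≡m)) (Q-least⇒ least (ψ y) (ψ-resp Qy))) ,
      Q-least⇒ least

∄-⇔ : {X Y : Set} {P : X → Set} {Q : Y → Set} →
      (φ : X → Y) → (∀ {x} → P x → Q (φ x)) → (ψ : Y → X) → (∀ {y} → Q y → P (ψ y)) →
      (∀ x → ¬ P x) ⇔ (∀ y → ¬ Q y)
∄-⇔ φ φ-resp ψ ψ-resp = mk⇔ (λ ∄P y Qy → ∄P (ψ y) (ψ-resp Qy)) (λ ∄Q x Px → ∄Q (φ x) (φ-resp Px))

All⊎⇒All⊎Any : {A : Set} {P Q : A → Set} {xs : List A} → All (λ x → P x ⊎ Q x) xs → All P xs ⊎ Any Q xs
All⊎⇒All⊎Any []              = inj₁ []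
All⊎⇒All⊎Any (inj₁ p ∷ pqs) = Sum.map (p ∷_) there (All⊎⇒All⊎Any pqs)
All⊎⇒All⊎Any (inj₂ q ∷ _)   = inj₂ (here q)

minInf≤ : ∀ h e → minInf h e ≤ h
minInf≤ h nothing  = ≤-refl
minInf≤ h (just e) = m⊓n≤m h e

module _ {n} {G : Graph n} {S : List (Subset n)} {o : ℕ} where

  order≤hitting : IsOrder G S o → ∀ {B} → Hits S B → o ≤ ∣ B ∣
  order≤hitting (h , e , (_ , least) , _ , refl) hits = ≤-trans (minInf≤ h e) (least _ hits)

  order≤cut : IsOrder G S o → ∀ {A} → Separates S A → o ≤ cut G A
  order≤cut (h , nothing , _ , ∄sep , _)           sep = ⊥-elim (∄sep _ sep)
  order≤cut (h , just e , _ , (_ , least) , refl) sep = ≤-trans (m⊓n≤n h e) (least _ sep)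

empty-scramble-order : ∀ {n} {G : Graph n} → IsOrder G [] 0
empty-scramble-order {n} = 0 , nothing , ((⊥ , [] , ∣⊥∣≡0 n) , λ _ _ → z≤n) , (λ _ ()) , refl

maxFin-upper : ∀ c (s : Fin c → ℕ) i → s i ≤ maxFin c s
maxFin-upper (suc c) s zero    = m≤m⊔n _ _
maxFin-upper (suc c) s (suc i) = ≤-trans (maxFin-upper c (s ∘ suc) i) (m≤n⊔m _ _)

maxFin-attained : ∀ c (s : Fin (suc c) → ℕ) → ∃[ i ] maxFin (suc c) s ≡ s i
maxFin-attained zero    s = zero , ⊔-identityʳ (s zero)
maxFin-attained (suc c) s with maxFin-attained c (s ∘ suc) | ⊔-sel (s zero) (maxFin (suc c) (s ∘ suc))
... | _ , _  | inj₁ max≡s₀   = zero , max≡s₀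
... | j , eq | inj₂ max≡rest = suc j , trans max≡rest eq

module ClosedInducedEmbedding {n m : ℕ} (G : Graph n) (H : Graph m) (f : Fin m → Fin n)
  (f-inj : Injective _≡_ _≡_ f)
  (induced : ∀ a b → mult H a b ≡ mult G (f a) (f b))
  (closed : ∀ a v → (∀ b → ¬ (f b ≡ v)) → mult G (f a) v ≡ 0) where

  image? : (A : Subset m) (v : Fin n) → Dec (∃[ a ] (f a ≡ v × a ∈ A))
  image? A v = any? λ a → (f a ≟ᶠ v) ×-dec (a ∈? A)

  image : Subset m → Subset n
  image A = tabulate (does ∘ image? A)

  preimage : Subset n → Subset m
  preimage B = tabulate (lookup B ∘ f)

  lookup-image : ∀ A v → lookup (image A) v ≡ does (image? A v)
  lookup-image A = lookup∘tabulate (does ∘ image? A)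

  lookup-preimage : ∀ B a → lookup (preimage B) a ≡ lookup B (f a)
  lookup-preimage B = lookup∘tabulate (lookup B ∘ f)

  ∈-image⁻ : ∀ {A v} → v ∈ image A → ∃[ a ] (f a ≡ v × a ∈ A)
  ∈-image⁻ {A} {v} v∈ = does≡true⇒ (image? A v) (trans (sym (lookup-image A v)) ([]=⇒lookup v∈))

  ∈-image⁺ : ∀ {A a} → a ∈ A → f a ∈ image A
  ∈-image⁺ {A} {a} a∈ =
    lookup⇒[]= (f a) (image A) (trans (lookup-image A (f a)) (dec-true (image? A (f a)) (a , refl , a∈)))

  witness⇒∈ : ∀ {A a} → ∃[ b ] (f b ≡ f a × b ∈ A) → a ∈ A
  witness⇒∈ {A} (b , fb≡fa , b∈) = subst (_∈ A) (f-inj fb≡fa) b∈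

  f∈image⁻ : ∀ {A a} → f a ∈ image A → a ∈ A
  f∈image⁻ = witness⇒∈ ∘ ∈-image⁻

  lookup-image-f : ∀ A a → lookup (image A) (f a) ≡ lookup A a
  lookup-image-f A a = begin
    lookup (image A) (f a)   ≡⟨ lookup-image A (f a) ⟩
    does (image? A (f a))    ≡⟨ does-⇔ (mk⇔ witness⇒∈ (λ a∈ → a , refl , a∈)) (image? A (f a)) (a ∈? A) ⟩
    does (a ∈? A)            ≡⟨ lookup≡does-∈? a A ⟨
    lookup A a               ∎
    where open ≡-Reasoning

  lookup-image-∉ : ∀ A {v} → (∀ a → f a ≢ v) → lookup (image A) v ≡ false
  lookup-image-∉ A {v} v∉ = trans (lookup-image A v) (dec-false (image? A v) λ (a , fa≡v , _) → v∉ a fa≡v)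

  ∈-preimage⁺ : ∀ {B a} → f a ∈ B → a ∈ preimage B
  ∈-preimage⁺ {B} {a} = ∈-resp-lookup (sym (lookup-preimage B a))

  ∈-preimage⁻ : ∀ {B a} → a ∈ preimage B → f a ∈ B
  ∈-preimage⁻ {B} {a} = ∈-resp-lookup (lookup-preimage B a)

  image-mono : ∀ {E A} → E ⊆ A → image E ⊆ image A
  image-mono E⊆A v∈ with ∈-image⁻ v∈
  ... | a , refl , a∈E = ∈-image⁺ (E⊆A a∈E)

  image-∁ : ∀ {E A} → E ⊆ ∁ A → image E ⊆ ∁ (image A)
  image-∁ E⊆∁A v∈ with ∈-image⁻ v∈
  ... | a , refl , a∈E = x∉p⇒x∈∁p (x∈∁p⇒x∉p (E⊆∁A a∈E) ∘ f∈image⁻)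

  image⊆⇒⊆preimage : ∀ {E B} → image E ⊆ B → E ⊆ preimage B
  image⊆⇒⊆preimage imE⊆B a∈E = ∈-preimage⁺ (imE⊆B (∈-image⁺ a∈E))

  image⊆∁⇒⊆∁preimage : ∀ {E B} → image E ⊆ ∁ B → E ⊆ ∁ (preimage B)
  image⊆∁⇒⊆∁preimage imE⊆∁B a∈E = x∉p⇒x∈∁p (x∈∁p⇒x∉p (imE⊆∁B (∈-image⁺ a∈E)) ∘ ∈-preimage⁻)

  image-preimage : ∀ {E} → E ⊆ image ⊤ → image (preimage E) ≡ E
  image-preimage {E} E⊆im = ⊆-antisym ⊆E E⊆
    where
    ⊆E : image (preimage E) ⊆ E
    ⊆E v∈ with ∈-image⁻ v∈
    ... | a , refl , a∈ = ∈-preimage⁻ a∈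
    E⊆ : E ⊆ image (preimage E)
    E⊆ v∈ with ∈-image⁻ (E⊆im v∈)
    ... | a , refl , _ = ∈-image⁺ (∈-preimage⁺ v∈)

  map-image-preimage : ∀ {S} → All (_⊆ image ⊤) S → map image (map preimage S) ≡ S
  map-image-preimage []           = refl
  map-image-preimage (E⊆ ∷ S⊆) = cong₂ _∷_ (image-preimage E⊆) (map-image-preimage S⊆)

  ∣image∣ : ∀ A → ∣ image A ∣ ≡ ∣ A ∣
  ∣image∣ A = begin
    ∣ image A ∣                          ≡⟨ ∣p∣≡sumFin-indicator (image A) ⟩
    sumFin n (indicator (image A))       ≡⟨ sumFin-∘-injective f-inj _ outside ⟨
    sumFin m (indicator (image A) ∘ f)   ≡⟨ sumFin-cong m (cong (if_then 1 else 0) ∘ lookup-image-f A) ⟩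
    sumFin m (indicator A)               ≡⟨ ∣p∣≡sumFin-indicator A ⟨
    ∣ A ∣                                ∎
    where
    open ≡-Reasoning
    outside : ∀ v → (∀ a → f a ≢ v) → indicator (image A) v ≡ 0
    outside v v∉ = cong (if_then 1 else 0) (lookup-image-∉ A v∉)

  ∣preimage∣≤ : ∀ B → ∣ preimage B ∣ ≤ ∣ B ∣
  ∣preimage∣≤ B = begin
    ∣ preimage B ∣                   ≡⟨ ∣p∣≡sumFin-indicator (preimage B) ⟩
    sumFin m (indicator (preimage B)) ≡⟨ sumFin-cong m (cong (if_then 1 else 0) ∘ lookup-preimage B) ⟩
    sumFin m (indicator B ∘ f)       ≤⟨ sumFin-∘-injective-≤ f-inj (indicator B) ⟩
    sumFin n (indicator B)           ≡⟨ ∣p∣≡sumFin-indicator B ⟨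
    ∣ B ∣                            ∎
    where open ≤-Reasoning

  cut-image : ∀ A → cut G (image A) ≡ cut H A
  cut-image A = begin
    sumFin n (λ u → sumFin n (crossing G (image A) u))
      ≡⟨ sumFin-∘-injective f-inj _ outside ⟨
    sumFin m (λ a → sumFin n (crossing G (image A) (f a)))
      ≡⟨ sumFin-cong m (λ a → sumFin-∘-injective f-inj _ (leaving a)) ⟨
    sumFin m (λ a → sumFin m (λ b → crossing G (image A) (f a) (f b)))
      ≡⟨ sumFin-cong m (λ a → sumFin-cong m (crossing-image a)) ⟩
    sumFin m (λ a → sumFin m (crossing H A a)) ∎
    where
    open ≡-Reasoning
    outside : ∀ u → (∀ a → f a ≢ u) → sumFin n (crossing G (image A) u) ≡ 0
    outside u u∉ = sumFin-zero n λ v →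
      cong (λ x → if x ∧ not (lookup (image A) v) then mult G u v else 0) (lookup-image-∉ A u∉)
    leaving : ∀ a v → (∀ b → f b ≢ v) → crossing G (image A) (f a) v ≡ 0
    leaving a v v∉ = trans (cong (if b then_else 0) (closed a v v∉)) (if-eta b)
      where b = lookup (image A) (f a) ∧ not (lookup (image A) v)
    crossing-image : ∀ a b → crossing G (image A) (f a) (f b) ≡ crossing H A a b
    crossing-image a b rewrite lookup-image-f A a | lookup-image-f A b | induced a b = refl

  cut-preimage≤ : ∀ B → cut H (preimage B) ≤ cut G B
  cut-preimage≤ B = begin
    sumFin m (λ a → sumFin m (crossing H (preimage B) a))
      ≡⟨ sumFin-cong m (λ a → sumFin-cong m (crossing-preimage a)) ⟩
    sumFin m (λ a → sumFin m (λ b → crossing G B (f a) (f b)))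
      ≤⟨ sumFin-mono m (λ a → sumFin-∘-injective-≤ f-inj (crossing G B (f a))) ⟩
    sumFin m (λ a → sumFin n (crossing G B (f a)))
      ≤⟨ sumFin-∘-injective-≤ f-inj (λ u → sumFin n (crossing G B u)) ⟩
    sumFin n (λ u → sumFin n (crossing G B u)) ∎
    where
    open ≤-Reasoning
    crossing-preimage : ∀ a b → crossing H (preimage B) a b ≡ crossing G B (f a) (f b)
    crossing-preimage a b rewrite lookup-preimage B a | lookup-preimage B b | induced a b = refl

  hits-image : ∀ {T B} → Hits T B → Hits (map image T) (image B)
  hits-image = All.map⁺ ∘ All.map λ (a , a∈E , a∈B) → f a , ∈-image⁺ a∈E , ∈-image⁺ a∈B

  hits-preimage : ∀ {T B} → Hits (map image T) B → Hits T (preimage B)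
  hits-preimage = All.map meet ∘ All.map⁻
    where
    meet : ∀ {E B} → ∃[ v ] (v ∈ image E × v ∈ B) → ∃[ a ] (a ∈ E × a ∈ preimage B)
    meet (v , v∈E , v∈B) with ∈-image⁻ v∈E
    ... | a , refl , a∈E = a , a∈E , ∈-preimage⁺ v∈B

  separates-image : ∀ {T A} → Separates T A → Separates (map image T) (image A)
  separates-image (inside , outside) = Any.map⁺ (Any.map image-mono inside) , Any.map⁺ (Any.map image-∁ outside)

  separates-preimage : ∀ {T B} → Separates (map image T) B → Separates T (preimage B)
  separates-preimage (inside , outside) =
    Any.map image⊆⇒⊆preimage (Any.map⁻ inside) , Any.map image⊆∁⇒⊆∁preimage (Any.map⁻ outside)

  IsOrder-image-⇔ : ∀ {T o} → IsOrder H T o ⇔ IsOrder G (map image T) o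
  IsOrder-image-⇔ {T} = mk⇔
    (λ (h , e , hn , en , o≡) → h , e , to hitting hn , to (eggCut e) en , o≡)
    (λ (h , e , hn , en , o≡) → h , e , from hitting hn , from (eggCut e) en , o≡)
    where
    hitting : ∀ {h} → IsHittingNumber T h ⇔ IsHittingNumber (map image T) h
    hitting = IsLeast-⇔ image hits-image ∣image∣ preimage hits-preimage ∣preimage∣≤
    eggCut : ∀ e → IsEggCutNumber H T e ⇔ IsEggCutNumber G (map image T) e
    eggCut nothing  = ∄-⇔ image separates-image preimage separates-preimage
    eggCut (just e) = IsLeast-⇔ image separates-image cut-image preimage separates-preimage cut-preimage≤

  walk-image : ∀ {A a b} → WalkIn H A a b → WalkIn G (image A) (f a) (f b)
  walk-image (stop a∈)       = stop (∈-image⁺ a∈)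
  walk-image (step a∈ edge w) = step (∈-image⁺ a∈) (subst (0 <_) (induced _ _) edge) (walk-image w)

  walk-preimage : ∀ {A u v a b} → WalkIn G (image A) u v → f a ≡ u → f b ≡ v → WalkIn H A a b
  walk-preimage (stop u∈) refl fb≡fa with f-inj fb≡fa
  ... | refl = stop (f∈image⁻ u∈)
  walk-preimage {a = a} (step u∈ edge w) refl fb≡v with ∈-image⁻ (walkIn-head w)
  ... | c , refl , _ = step (f∈image⁻ u∈) (subst (0 <_) (sym (induced a c)) edge) (walk-preimage w refl fb≡v)

  egg-image : ∀ {A} → Egg H A → Egg G (image A)
  egg-image {A} ((a , a∈) , walks) = (f a , ∈-image⁺ a∈) , walks′
    where
    walks′ : ∀ {u v} → u ∈ image A → v ∈ image A → WalkIn G (image A) u v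
    walks′ u∈ v∈ with ∈-image⁻ u∈ | ∈-image⁻ v∈
    ... | a , refl , a∈ | b , refl , b∈ = walk-image (walks a∈ b∈)

  egg-image⁻ : ∀ {A} → Egg G (image A) → Egg H A
  egg-image⁻ ((v , v∈) , walks) with ∈-image⁻ v∈
  ... | a , _ , a∈ = (a , a∈) , λ a∈ b∈ → walk-preimage (walks (∈-image⁺ a∈) (∈-image⁺ b∈)) refl refl

  image-scramble : ∀ {T o} → IsScramble H T → IsOrder H T o →
                   IsScramble G (map image T) × IsOrder G (map image T) o
  image-scramble eggs ord = All.map⁺ (All.map egg-image eggs) , to IsOrder-image-⇔ ord

  preimage-scramble : ∀ {S o} → All (_⊆ image ⊤) S → IsScramble G S → IsOrder G S o →
                      IsScramble H (map preimage S) × IsOrder H (map preimage S) o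
  preimage-scramble {S} {o} S⊆im eggs ord =
    All.map egg-image⁻ (All.map⁻ (subst (IsScramble G) S≡ eggs)) ,
    from IsOrder-image-⇔ (subst (λ S′ → IsOrder G S′ o) S≡ ord)
    where
    S≡ : S ≡ map image (map preimage S)
    S≡ = sym (map-image-preimage S⊆im)

module _ {n c : ℕ} {G : Graph n} (K : Components G c) where
  open Components K

  private
    module Emb (i : Fin c) = ClosedInducedEmbedding G (comp i) (emb i) (emb-inj i) (induced i) (closed i)

  vertices : Fin c → Subset n
  vertices i = Emb.image i ⊤

  component : Fin n → Fin c
  component v = proj₁ (cover v)

  component-emb : ∀ i a → component (emb i a) ≡ i
  component-emb i a = disjoint _ i _ a (proj₂ (proj₂ (cover (emb i a))))

  ∈-vertices-component : ∀ v → v ∈ vertices (component v)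
  ∈-vertices-component v with cover v
  ... | i , a , refl = Emb.∈-image⁺ i ∈⊤

  ∈-vertices⁻ : ∀ {i v} → v ∈ vertices i → component v ≡ i
  ∈-vertices⁻ {i} v∈ with Emb.∈-image⁻ i v∈
  ... | a , refl , _ = component-emb i a

  component-edge : ∀ {u w} → 0 < mult G u w → component u ≡ component w
  component-edge {u} {w} edge with cover u
  ... | i , a , refl with any? (λ b → emb i b ≟ᶠ w)
  ...   | yes (b , refl) = sym (component-emb i b)
  ...   | no w∉ = ⊥-elim (<-irrefl (sym (closed i a w λ b eb → w∉ (b , eb))) edge)

  component-walk : ∀ {A u v} → WalkIn G A u v → component u ≡ component v
  component-walk (stop _)        = refl
  component-walk (step _ edge w) = trans (component-edge edge) (component-walk w)

  egg-⊆-vertices : ∀ {E} → Egg G E → ∃[ i ] E ⊆ vertices i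
  egg-⊆-vertices ((w , w∈) , walks) =
    component w ,
    λ {v} v∈ → subst (λ i → v ∈ vertices i) (component-walk (walks v∈ w∈)) (∈-vertices-component v)

  egg-⊆-or-⊆∁ : ∀ {E} → Egg G E → ∀ i → E ⊆ vertices i ⊎ E ⊆ ∁ (vertices i)
  egg-⊆-or-⊆∁ egg i with egg-⊆-vertices egg
  ... | j , E⊆j with j ≟ᶠ i
  ...   | yes refl = inj₁ E⊆j
  ...   | no j≢i   = inj₂ λ v∈ → x∉p⇒x∈∁p λ v∈i →
    j≢i (trans (sym (∈-vertices⁻ (E⊆j v∈))) (∈-vertices⁻ v∈i))

  cut-vertices : ∀ i → cut G (vertices i) ≡ 0
  cut-vertices i = trans (Emb.cut-image i ⊤) (cut-⊤ (comp i))

  component-scramble : ∀ i {t} → IsScrambleNumber (comp i) t → ∃[ S ] (IsScramble G S × IsOrder G S t)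
  component-scramble i ((T , eggs , ord) , _) = map (Emb.image i) T , Emb.image-scramble i eggs ord

  order≤maxFin : (s : Fin c → ℕ) → (∀ i → IsScrambleNumber (comp i) (s i)) →
                 ∀ S o → IsScramble G S → IsOrder G S o → o ≤ maxFin c s
  order≤maxFin s sn [] o [] ord =
    ≤-trans (order≤hitting ord {⊥} []) (≤-trans (≤-reflexive (∣⊥∣≡0 n)) z≤n)
  order≤maxFin s sn (E₀ ∷ S) o eggs@(egg₀ ∷ _) ord with egg-⊆-vertices egg₀
  ... | i , E₀⊆i with All⊎⇒All⊎Any (All.map (λ egg → egg-⊆-or-⊆∁ egg i) eggs)
  ...   | inj₁ inside =
    let eggsᵢ , ordᵢ = Emb.preimage-scramble i inside eggs ord
    in ≤-trans (proj₂ (sn i) _ o eggsᵢ ordᵢ) (maxFin-upper c s i)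
  ...   | inj₂ outside =
    ≤-trans (order≤cut ord (here E₀⊆i , outside)) (≤-trans (≤-reflexive (cut-vertices i)) z≤n)

lemma2p2 : ∀ {n : ℕ} (G : Graph n) (c : ℕ) (K : Components G c)
             (s : Fin c → ℕ) →
             (∀ i → IsScrambleNumber (Components.comp K i) (s i)) →
             IsScrambleNumber G (maxFin c s)
lemma2p2 G zero K s sn = ([] , [] , empty-scramble-order) , order≤maxFin K s sn
lemma2p2 G (suc c) K s sn with maxFin-attained c s
... | i , max≡sᵢ =
  subst (λ t → ∃[ S ] (IsScramble G S × IsOrder G S t)) (sym max≡sᵢ) (component-scramble K i (sn i)) ,
  order≤maxFin K s sn
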